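{- Let $G'=(V',E')$ be a graph and $k'$ an integer, and let $(G,k)$ be the instance constructed from $(G',k')$ as described in the context. If $G'$ has a vertex cover of size at most $k'$, then $G$ has a hub labeling of size at most $k$.
   Context: A hub labeling of a graph $G=(V,E)$ is a map $\ell:V\to 2^V$ such that for all $u,v\in V$ (including $u=v$) some vertex of some shortest $u$-$v$-path in $G$ lies in $\ell(u)\cap\ell(v)$; its size is $\sum_{v\in V}|\ell(v)|$. Construction: from a graph $G'=(V',E')$ and integer $k'$, let $\gamma:=8|V'|+3|E'|+k'+2$, $W:=\{w_1,\dots,w_\gamma\}$, $V:=\{w\}\cup W\cup\{v_1,v_2,v_3\mid v\in V'\}$ (all new distinct vertices), $E:=\bigcup_{v\in V'}\{wv_1,v_1v_2,v_2v_3\}\cup\{wx\mid x\in W\}\cup\{u_1v_1\mid uv\in E'\}$, $G=(V,E)$, and $k:=3\gamma-1$. -}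

module Defs where

open import Data.Nat using (ℕ; zero; suc; _+_; _*_; _≤_; _∸_)
open import Data.Fin using (Fin; zero; suc; _↑ˡ_; _↑ʳ_; combine)
import Data.Fin as F
open import Data.Fin.Subset using (Subset; _∈_; ∣_∣)
open import Data.List using (List; []; _∷_; length; map; _++_; allFin)
open import Data.Nat.ListAction using (sum)
open import Data.List.Membership.Propositional renaming (_∈_ to _∈L_)
open import Data.List.Relation.Unary.All using (All)
open import Data.List.Relation.Unary.Unique.Propositional using (Unique)
open import Data.Product using (Σ; ∃; _×_; _,_; proj₁; proj₂)
open import Data.Sum using (_⊎_)
open import Relation.Binary.PropositionalEquality using (_≡_)

-- A graph with vertex set Fin n, given by its list of edges.
-- Each edge (u , v) stands for the undirected edge uv.
record Graph : Set where
  constructor mkGraph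
  field
    n     : ℕ
    edges : List (Fin n × Fin n)
open Graph public

-- Simple (undirected, loopless) graph in canonical form: every edge is
-- stored once, as (u , v) with u < v.  Then |E| = length edges.
Simple : Graph → Set
Simple G = All (λ e → proj₁ e F.< proj₂ e) (edges G) × Unique (edges G)

Adj : (G : Graph) → Fin (n G) → Fin (n G) → Set
Adj G u v = ((u , v) ∈L edges G) ⊎ ((v , u) ∈L edges G)

data Walk (G : Graph) : Fin (n G) → Fin (n G) → Set where
  []  : ∀ {u} → Walk G u u
  _∷_ : ∀ {u v x} → Adj G u v → Walk G v x → Walk G u x

len : ∀ {G u v} → Walk G u v → ℕ
len []      = 0
len (_ ∷ p) = suc (len p)

data _OnWalk_ {G : Graph} (x : Fin (n G)) : ∀ {u v} → Walk G u v → Set where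
  here  : ∀ {v} {p : Walk G x v} → x OnWalk p
  there : ∀ {u y v} {a : Adj G u y} {p : Walk G y v} → x OnWalk p → x OnWalk (a ∷ p)

-- a shortest u-v path: a walk of minimum length (such a walk is a path)
IsShortest : ∀ {G u v} → Walk G u v → Set
IsShortest {G} {u} {v} p = ∀ (q : Walk G u v) → len p ≤ len q

-- hub labeling (including u = v)
IsHubLabeling : (G : Graph) → (Fin (n G) → Subset (n G)) → Set
IsHubLabeling G ℓ =
  ∀ (u v : Fin (n G)) → Σ (Walk G u v) λ p → IsShortest p ×
    ∃ λ x → x OnWalk p × x ∈ ℓ u × x ∈ ℓ v

hlSize : (G : Graph) → (Fin (n G) → Subset (n G)) → ℕ
hlSize G ℓ = sum (map (λ v → ∣ ℓ v ∣) (allFin (n G)))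

VertexCover : (G : Graph) → Subset (n G) → Set
VertexCover G C = All (λ e → proj₁ e ∈ C ⊎ proj₂ e ∈ C) (edges G)

gamma : Graph → ℕ → ℕ
gamma G' k' = 8 * n G' + 3 * length (edges G') + k' + 2

-- vertex set: w = 0, w_i = 1 + i, v_j = 1 + γ + 3v + (j-1)
module Construction (G' : Graph) (k' : ℕ) where
  γ : ℕ
  γ = gamma G' k'

  N : ℕ
  N = suc (γ + n G' * 3)

  wV : Fin N
  wV = zero

  wI : Fin γ → Fin N
  wI i = suc (i ↑ˡ (n G' * 3))

  vJ : Fin (n G') → Fin 3 → Fin N
  vJ v j = suc (γ ↑ʳ combine v j)

  v₁ v₂ v₃ : Fin (n G') → Fin N
  v₁ v = vJ v zero
  v₂ v = vJ v (suc zero)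
  v₃ v = vJ v (suc (suc zero))

  E : List (Fin N × Fin N)
  E = map (λ v → (wV , v₁ v)) (allFin (n G'))
   ++ map (λ v → (v₁ v , v₂ v)) (allFin (n G'))
   ++ map (λ v → (v₂ v , v₃ v)) (allFin (n G'))
   ++ map (λ i → (wV , wI i)) (allFin γ)
   ++ map (λ e → (v₁ (proj₁ e) , v₁ (proj₂ e))) (edges G')

  G : Graph
  G = mkGraph N E

  k : ℕ
  k = 3 * γ ∸ 1

constructG : Graph → ℕ → Graph
constructG = Construction.G

constructK : Graph → ℕ → ℕ
constructK = Construction.k

-- Take the hub labels from a vertex cover C of G'.  Every vertex is labelled by itself and the
-- centre w, which serves all pairs whose shortest path runs through w.  Inside the chain v₁v₂v₃
-- of v the labels of v₂, v₃ get {v₁}, {v₁,v₂} if v ∈ C and those of v₁, v₃ get {v₂} otherwise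
-- (3 resp. 2 entries).  For an edge uv of G' with u ∈ C, the three labels of the chain of v
-- get u₁, which is a hub on the shortest path through the edge u₁v₁.  That the chosen walks are
-- shortest is certified by an explicit distance function, 1-Lipschitz along edges.  Counting,
-- the labels have 1 + 2γ + 8|V'| + |C| + 3|E'| ≤ 3γ − 1 entries, which is how γ was chosen.

module Submission where

open import Defs
open import Data.Nat using (ℕ; zero; suc; _+_; _*_; _∸_; _≤_; _≤?_; z≤n; s≤s; ∣_-_∣)
open import Data.Nat.Properties
import Data.Nat.ListAction as List
open import Data.Bool using (Bool; true; false; if_then_else_)
open import Data.Fin using (Fin; zero; suc; _↑ˡ_; _↑ʳ_; combine; remQuot; splitAt; join; toℕ)
open import Data.Fin.Patterns using (0F; 1F; 2F)
import Data.Fin.Properties as Fin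
open import Data.Fin.Subset using (Subset; ∣_∣; _∪_; ⁅_⁆; ⋃; _∈_)
open import Data.Fin.Subset.Properties using (∣⊥∣≡0; ∣⁅x⁆∣≡1; x∈⁅x⁆; p⊆p∪q; q⊆p∪q)
open import Data.Vec using ([]; _∷_; lookup)
open import Data.Vec.Properties using ([]=⇒lookup)
import Data.List.Relation.Unary.All as All
open import Data.List using (List; []; _∷_; _++_; length; map; allFin; tabulate)
open import Data.List.Properties using (length-map)
open import Data.List.Membership.Propositional.Properties using (∈-++⁺ˡ; ∈-++⁺ʳ; ∈-++⁻; ∈-map⁺; ∈-map⁻; ∈-allFin)
open import Data.List.Membership.Propositional using () renaming (_∈_ to _∈ᴸ_)
open import Data.List.Relation.Unary.Any using (here; there)
open import Data.Product using (Σ; ∃; _×_; _,_; proj₁; proj₂)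
open import Data.Product.Properties using (≡-dec)
import Data.List.Membership.DecPropositional as DecMembership
open import Data.Sum using (_⊎_; inj₁; inj₂)
open import Relation.Nullary using (Dec; yes; no; does; contradiction)
open import Relation.Nullary.Decidable using (True; toWitness; _×-dec_; _⊎-dec_; dec-true; dec-false)
open import Function using (_∘_; id)
open import Relation.Binary.PropositionalEquality
open import Data.Nat.Tactic.RingSolver using (solve-∀)
open import Algebra.Properties.CommutativeMonoid.Sum +-0-commutativeMonoid
  using (sum; sum-syntax; sum-cong-≗; ∑-distrib-+)

χ : Bool → ℕ
χ b = if b then 1 else 0

∑-mono-≤ : ∀ {m} {f g : Fin m → ℕ} → (∀ i → f i ≤ g i) → sum f ≤ sum g
∑-mono-≤ {zero}  f≤g = z≤n
∑-mono-≤ {suc m} f≤g = +-mono-≤ (f≤g zero) (∑-mono-≤ (f≤g ∘ suc))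

∑-const : ∀ m c → ∑[ i < m ] c ≡ m * c
∑-const zero    c = refl
∑-const (suc m) c = cong (c +_) (∑-const m c)

∑-*-distribˡ : ∀ {m} c (f : Fin m → ℕ) → ∑[ i < m ] (c * f i) ≡ c * sum f
∑-*-distribˡ {zero}  c f = sym (*-zeroʳ c)
∑-*-distribˡ {suc m} c f = begin
  c * f zero + ∑[ i < m ] (c * f (suc i))  ≡⟨ cong (c * f zero +_) (∑-*-distribˡ c (f ∘ suc)) ⟩
  c * f zero + c * sum (f ∘ suc)           ≡⟨ *-distribˡ-+ c (f zero) _ ⟨
  c * sum f                                ∎
  where open ≡-Reasoning

∑-↑ : ∀ m n (f : Fin (m + n) → ℕ) →
      sum f ≡ ∑[ i < m ] f (i ↑ˡ n) + ∑[ j < n ] f (m ↑ʳ j)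
∑-↑ zero    n f = refl
∑-↑ (suc m) n f = trans (cong (f zero +_) (∑-↑ m n (f ∘ suc))) (sym (+-assoc (f zero) _ _))

∑-combine : ∀ m n (f : Fin (m * n) → ℕ) →
            sum f ≡ ∑[ i < m ] ∑[ j < n ] f (combine i j)
∑-combine zero    n f = refl
∑-combine (suc m) n f =
  trans (∑-↑ n (m * n) f) (cong (∑[ j < n ] f (j ↑ˡ (m * n)) +_) (∑-combine m n (f ∘ (n ↑ʳ_))))

∑-χ-≟ : ∀ {m} (c : Fin m) → ∑[ v < m ] χ (does (c Fin.≟ v)) ≡ 1
∑-χ-≟ {suc m} zero    = cong suc (trans (∑-const m 0) (*-zeroʳ m))
∑-χ-≟ {suc m} (suc c) = ∑-χ-≟ c

∑-χ-lookup : ∀ {m} (p : Subset m) → ∑[ v < m ] χ (lookup p v) ≡ ∣ p ∣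
∑-χ-lookup []          = refl
∑-χ-lookup (true ∷ p)  = cong suc (∑-χ-lookup p)
∑-χ-lookup (false ∷ p) = ∑-χ-lookup p

sum-map-tabulate : ∀ {A : Set} m (f : Fin m → A) (g : A → ℕ) →
                   List.sum (map g (tabulate f)) ≡ ∑[ i < m ] g (f i)
sum-map-tabulate zero    f g = refl
sum-map-tabulate (suc m) f g = cong (g (f zero) +_) (sum-map-tabulate m (f ∘ suc) g)

∣p∪q∣≤∣p∣+∣q∣ : ∀ {m} (p q : Subset m) → ∣ p ∪ q ∣ ≤ ∣ p ∣ + ∣ q ∣
∣p∪q∣≤∣p∣+∣q∣ []          []          = z≤n
∣p∪q∣≤∣p∣+∣q∣ (true  ∷ p) (false ∷ q) = s≤s (∣p∪q∣≤∣p∣+∣q∣ p q)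
∣p∪q∣≤∣p∣+∣q∣ (true  ∷ p) (true  ∷ q) = s≤s (≤-trans (∣p∪q∣≤∣p∣+∣q∣ p q) (+-monoʳ-≤ ∣ p ∣ (n≤1+n ∣ q ∣)))
∣p∪q∣≤∣p∣+∣q∣ (false ∷ p) (true  ∷ q) = ≤-trans (s≤s (∣p∪q∣≤∣p∣+∣q∣ p q)) (≤-reflexive (sym (+-suc _ _)))
∣p∪q∣≤∣p∣+∣q∣ (false ∷ p) (false ∷ q) = ∣p∪q∣≤∣p∣+∣q∣ p q

fromList : ∀ {m} → List (Fin m) → Subset m
fromList xs = ⋃ (map ⁅_⁆ xs)

∈ᴸ⇒∈fromList : ∀ {m} {x : Fin m} {xs} → x ∈ᴸ xs → x ∈ fromList xs
∈ᴸ⇒∈fromList {xs = y ∷ ys} (here refl) = p⊆p∪q (fromList ys) (x∈⁅x⁆ y)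
∈ᴸ⇒∈fromList {xs = y ∷ ys} (there x∈ys) = q⊆p∪q ⁅ y ⁆ (fromList ys) (∈ᴸ⇒∈fromList x∈ys)

∣fromList∣≤length : ∀ {m} (xs : List (Fin m)) → ∣ fromList xs ∣ ≤ length xs
∣fromList∣≤length {m} []       = ≤-reflexive (∣⊥∣≡0 m)
∣fromList∣≤length     (x ∷ xs) = begin
  ∣ ⁅ x ⁆ ∪ fromList xs ∣       ≤⟨ ∣p∪q∣≤∣p∣+∣q∣ ⁅ x ⁆ (fromList xs) ⟩
  ∣ ⁅ x ⁆ ∣ + ∣ fromList xs ∣   ≤⟨ +-mono-≤ (≤-reflexive (∣⁅x⁆∣≡1 x)) (∣fromList∣≤length xs) ⟩
  suc (length xs)               ∎
  where open ≤-Reasoning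

module _ {G : Graph} where

  _++ʷ_ : ∀ {u v x} → Walk G u v → Walk G v x → Walk G u x
  []      ++ʷ q = q
  (a ∷ p) ++ʷ q = a ∷ (p ++ʷ q)

  len-++ʷ : ∀ {u v x} (p : Walk G u v) (q : Walk G v x) → len (p ++ʷ q) ≡ len p + len q
  len-++ʷ []      q = refl
  len-++ʷ (a ∷ p) q = cong suc (len-++ʷ p q)

  OnWalk-++ʷˡ : ∀ {y u v x} {p : Walk G u v} {q : Walk G v x} → y OnWalk p → y OnWalk (p ++ʷ q)
  OnWalk-++ʷˡ here      = here
  OnWalk-++ʷˡ (there o) = there (OnWalk-++ʷˡ o)

  OnWalk-++ʷʳ : ∀ {y u v x} (p : Walk G u v) {q : Walk G v x} → y OnWalk q → y OnWalk (p ++ʷ q)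
  OnWalk-++ʷʳ []      o = o
  OnWalk-++ʷʳ (a ∷ p) o = there (OnWalk-++ʷʳ p o)

  target-OnWalk : ∀ {u v} (p : Walk G u v) → v OnWalk p
  target-OnWalk []      = here
  target-OnWalk (a ∷ p) = there (target-OnWalk p)

  Lipschitz : (Fin (n G) → ℕ) → Set
  Lipschitz d = ∀ {u v} → Adj G u v → d u ≤ suc (d v)

  len-≥-potential : ∀ {d} → Lipschitz d → ∀ {s t} (p : Walk G s t) → d s ≤ len p + d t
  len-≥-potential lip []      = ≤-refl
  len-≥-potential lip (a ∷ p) = ≤-trans (lip a) (s≤s (len-≥-potential lip p))

  shortest-by-potential : ∀ {d} → Lipschitz d → ∀ {s t} → d t ≡ 0 →
                          (p : Walk G s t) → len p ≡ d s → IsShortest p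
  shortest-by-potential {d} lip {s} {t} dt≡0 p len≡ q = begin
    len p          ≡⟨ len≡ ⟩
    d s            ≤⟨ len-≥-potential lip q ⟩
    len q + d t    ≡⟨ cong (len q +_) dt≡0 ⟩
    len q + 0      ≡⟨ +-identityʳ (len q) ⟩
    len q          ∎
    where open ≤-Reasoning

Near : ℕ → ℕ → Set
Near a b = a ≤ suc b × b ≤ suc a

Near? : ∀ a b → Dec (Near a b)
Near? a b = (a ≤? suc b) ×-dec (b ≤? suc a)

near : ∀ {a b} {t : True (Near? a b)} → Near a b
near {t = t} = toWitness t

near-refl : ∀ a → Near a a
near-refl a = n≤1+n a , n≤1+n a

near-suc : ∀ a → Near a (suc a)
near-suc a = m≤n⇒m≤1+n (n≤1+n a) , ≤-refl

near-suc˘ : ∀ a → Near (suc a) a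
near-suc˘ a = ≤-refl , m≤n⇒m≤1+n (n≤1+n a)

near-∣-∣ : ∀ m n → Near ∣ m - n ∣ ∣ suc m - n ∣
near-∣-∣ zero    zero    = near
near-∣-∣ zero    (suc n) = near-suc˘ n
near-∣-∣ (suc m) zero    = near-suc (suc m)
near-∣-∣ (suc m) (suc n) = near-∣-∣ m n

module Reduction (G' : Graph) (k' : ℕ) (C : Subset (n G')) (cover : VertexCover G' C) where
  open Construction G' k'

  n' : ℕ
  n' = n G'

  E' : List (Fin n' × Fin n')
  E' = edges G'

  -- vⱼ v j is the vertex v_(j+1) of the chain of v.
  data Vertex : Set where
    w  : Vertex
    wᵢ : Fin γ → Vertex
    vⱼ : Fin n' → Fin 3 → Vertex

  toFin : Vertex → Fin N
  toFin w        = wV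
  toFin (wᵢ i)   = wI i
  toFin (vⱼ v j) = vJ v j

  fromSplit : Fin γ ⊎ Fin (n' * 3) → Vertex
  fromSplit (inj₁ i) = wᵢ i
  fromSplit (inj₂ c) = let (v , j) = remQuot {n'} 3 c in vⱼ v j

  fromFin : Fin N → Vertex
  fromFin zero    = w
  fromFin (suc x) = fromSplit (splitAt γ x)

  fromFin-toFin : ∀ a → fromFin (toFin a) ≡ a
  fromFin-toFin w        = refl
  fromFin-toFin (wᵢ i)   = cong fromSplit (Fin.splitAt-↑ˡ γ i (n' * 3))
  fromFin-toFin (vⱼ v j) = begin
    fromSplit (splitAt γ (γ ↑ʳ combine v j))  ≡⟨ cong fromSplit (Fin.splitAt-↑ʳ γ (n' * 3) (combine v j)) ⟩
    fromSplit (inj₂ (combine v j))            ≡⟨ cong (λ (v , j) → vⱼ v j) (Fin.remQuot-combine v j) ⟩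
    vⱼ v j                                    ∎
    where open ≡-Reasoning

  toFin-fromSplit : ∀ s → toFin (fromSplit s) ≡ suc (join γ (n' * 3) s)
  toFin-fromSplit (inj₁ i) = refl
  toFin-fromSplit (inj₂ c) = cong (λ c → suc (γ ↑ʳ c)) (Fin.combine-remQuot {n'} 3 c)

  toFin-fromFin : ∀ x → toFin (fromFin x) ≡ x
  toFin-fromFin zero    = refl
  toFin-fromFin (suc x) = trans (toFin-fromSplit (splitAt γ x)) (cong suc (Fin.join-splitAt γ (n' * 3) x))

  data Edge : Vertex → Vertex → Set where
    w-v₁  : ∀ v → Edge w (vⱼ v 0F)
    v₁-v₂ : ∀ v → Edge (vⱼ v 0F) (vⱼ v 1F)
    v₂-v₃ : ∀ v → Edge (vⱼ v 1F) (vⱼ v 2F)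
    w-wᵢ  : ∀ i → Edge w (wᵢ i)
    u₁-v₁ : ∀ {u v} → (u , v) ∈ᴸ E' → Edge (vⱼ u 0F) (vⱼ v 0F)

  edgeList : ∀ {A : Set} → (A → Vertex) → (A → Vertex) → List A → List (Fin N × Fin N)
  edgeList f g = map (λ a → toFin (f a) , toFin (g a))

  E₁ E₂ E₃ E₄ : List (Fin N × Fin N)
  E₁ = edgeList (λ _ → w) (λ v → vⱼ v 0F) (allFin n')
  E₂ = edgeList (λ v → vⱼ v 0F) (λ v → vⱼ v 1F) (allFin n')
  E₃ = edgeList (λ v → vⱼ v 1F) (λ v → vⱼ v 2F) (allFin n')
  E₄ = edgeList (λ _ → w) wᵢ (allFin γ)

  Edge⇒∈E : ∀ {a b} → Edge a b → (toFin a , toFin b) ∈ᴸ E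
  Edge⇒∈E (w-v₁ v)  = ∈-++⁺ˡ (∈-map⁺ _ (∈-allFin v))
  Edge⇒∈E (v₁-v₂ v) = ∈-++⁺ʳ E₁ (∈-++⁺ˡ (∈-map⁺ _ (∈-allFin v)))
  Edge⇒∈E (v₂-v₃ v) = ∈-++⁺ʳ E₁ (∈-++⁺ʳ E₂ (∈-++⁺ˡ (∈-map⁺ _ (∈-allFin v))))
  Edge⇒∈E (w-wᵢ i)  = ∈-++⁺ʳ E₁ (∈-++⁺ʳ E₂ (∈-++⁺ʳ E₃ (∈-++⁺ˡ (∈-map⁺ _ (∈-allFin i)))))
  Edge⇒∈E (u₁-v₁ m) = ∈-++⁺ʳ E₁ (∈-++⁺ʳ E₂ (∈-++⁺ʳ E₃ (∈-++⁺ʳ E₄ (∈-map⁺ _ m))))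

  ∈edgeList⇒Edge : ∀ {A : Set} {f g : A → Vertex} {as} → (∀ {a} → a ∈ᴸ as → Edge (f a) (g a)) →
                   ∀ {x y} → (x , y) ∈ᴸ edgeList f g as → Edge (fromFin x) (fromFin y)
  ∈edgeList⇒Edge edge m with ∈-map⁻ _ m
  ... | a , a∈as , refl = subst₂ Edge (sym (fromFin-toFin _)) (sym (fromFin-toFin _)) (edge a∈as)

  ∈E⇒Edge : ∀ {x y} → (x , y) ∈ᴸ E → Edge (fromFin x) (fromFin y)
  ∈E⇒Edge m with ∈-++⁻ E₁ m
  ... | inj₁ m = ∈edgeList⇒Edge (λ {v} _ → w-v₁ v) m
  ... | inj₂ m with ∈-++⁻ E₂ m
  ... | inj₁ m = ∈edgeList⇒Edge (λ {v} _ → v₁-v₂ v) m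
  ... | inj₂ m with ∈-++⁻ E₃ m
  ... | inj₁ m = ∈edgeList⇒Edge (λ {v} _ → v₂-v₃ v) m
  ... | inj₂ m with ∈-++⁻ E₄ m
  ... | inj₁ m = ∈edgeList⇒Edge (λ {i} _ → w-wᵢ i) m
  ... | inj₂ m = ∈edgeList⇒Edge u₁-v₁ m

  adj? : ∀ v u → Dec (Adj G' v u)
  adj? v u = ((v , u) ∈? E') ⊎-dec ((u , v) ∈? E')
    where open DecMembership (≡-dec Fin._≟_ Fin._≟_) using (_∈?_)

  height : Vertex → ℕ
  height w        = 0
  height (wᵢ _)   = 1
  height (vⱼ _ j) = suc (toℕ j)

  chainDist : ∀ {v u} → Fin 3 → Fin 3 → Dec (v ≡ u) → Dec (Adj G' v u) → ℕ
  chainDist i j (yes _) _       = ∣ toℕ i - toℕ j ∣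
  chainDist i j (no _)  (yes _) = toℕ i + suc (toℕ j)
  chainDist i j (no _)  (no _)  = suc (toℕ i) + suc (toℕ j)

  -- The distance in G: height a + height b (through w) except inside one branch or across an edge u₁v₁.
  dist : Vertex → Vertex → ℕ
  dist a        w        = height a
  dist w        b        = height b
  dist (wᵢ i)   (wᵢ i')  = if does (i Fin.≟ i') then 0 else 2
  dist (vⱼ v i) (vⱼ u j) = chainDist i j (v Fin.≟ u) (adj? v u)
  dist a        b        = height a + height b

  dist-self : ∀ a → dist a a ≡ 0
  dist-self w = refl
  dist-self (wᵢ i) rewrite dec-true (i Fin.≟ i) refl = refl
  dist-self (vⱼ v j) with v Fin.≟ v
  ... | yes _ = ∣n-n∣≡0 (toℕ j)
  ... | no v≢v = contradiction refl v≢v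

  chainDist-step : ∀ {v u} i i' j (d : Dec (v ≡ u)) (a : Dec (Adj G' v u)) → toℕ i' ≡ suc (toℕ i) →
                   Near (chainDist i j d a) (chainDist i' j d a)
  chainDist-step i i' j (yes _) _       eq rewrite eq = near-∣-∣ (toℕ i) (toℕ j)
  chainDist-step i i' j (no _)  (yes _) eq rewrite eq = near-suc _
  chainDist-step i i' j (no _)  (no _)  eq rewrite eq = near-suc _

  chainDist-start : ∀ {v u} j (d : Dec (v ≡ u)) (a : Dec (Adj G' v u)) →
                    Near (suc (toℕ j)) (chainDist 0F j d a)
  chainDist-start j (yes _) _       = near-suc˘ _
  chainDist-start j (no _)  (yes _) = near-refl _
  chainDist-start j (no _)  (no _)  = near-suc _

  chainDist-u₁v₁ : ∀ {x y} u j → (x , y) ∈ᴸ E' →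
    Near (chainDist 0F j (x Fin.≟ u) (adj? x u)) (chainDist 0F j (y Fin.≟ u) (adj? y u))
  chainDist-u₁v₁ {x} {y} u j xy∈E' with x Fin.≟ u | adj? x u | y Fin.≟ u | adj? y u
  ... | yes _    | _        | yes _    | _      = near-refl _
  ... | yes refl | _        | no _     | yes _  = near-suc _
  ... | yes refl | _        | no _     | no ¬yx = contradiction (inj₂ xy∈E') ¬yx
  ... | no _     | yes _    | yes refl | _      = near-suc˘ _
  ... | no _     | no ¬xy   | yes refl | _      = contradiction (inj₁ xy∈E') ¬xy
  ... | no _     | yes _    | no _     | yes _  = near-refl _
  ... | no _     | yes _    | no _     | no _   = near-suc _
  ... | no _     | no _     | no _     | yes _  = near-suc˘ _
  ... | no _     | no _     | no _     | no _   = near-refl _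

  leafDist-near : ∀ b → Near 1 (if b then 0 else 2)
  leafDist-near true  = near
  leafDist-near false = near

  dist-near : ∀ b {x y} → Edge x y → Near (dist x b) (dist y b)
  dist-near w        (w-v₁ v)  = near
  dist-near w        (v₁-v₂ v) = near
  dist-near w        (v₂-v₃ v) = near
  dist-near w        (w-wᵢ i)  = near
  dist-near w        (u₁-v₁ _) = near
  dist-near (wᵢ i)   (w-v₁ v)  = near
  dist-near (wᵢ i)   (v₁-v₂ v) = near
  dist-near (wᵢ i)   (v₂-v₃ v) = near
  dist-near (wᵢ i)   (w-wᵢ i') = leafDist-near (does (i' Fin.≟ i))
  dist-near (wᵢ i)   (u₁-v₁ _) = near
  dist-near (vⱼ u j) (w-v₁ v)  = chainDist-start j (v Fin.≟ u) (adj? v u)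
  dist-near (vⱼ u j) (v₁-v₂ v) = chainDist-step 0F 1F j (v Fin.≟ u) (adj? v u) refl
  dist-near (vⱼ u j) (v₂-v₃ v) = chainDist-step 1F 2F j (v Fin.≟ u) (adj? v u) refl
  dist-near (vⱼ u j) (w-wᵢ i)  = near-suc _
  dist-near (vⱼ u j) (u₁-v₁ m) = chainDist-u₁v₁ u j m

  dist-lipschitz : ∀ b → Lipschitz {G} (λ x → dist (fromFin x) b)
  dist-lipschitz b (inj₁ xy∈E) = proj₁ (dist-near b (∈E⇒Edge xy∈E))
  dist-lipschitz b (inj₂ yx∈E) = proj₂ (dist-near b (∈E⇒Edge yx∈E))

  shortest-if-len≡dist : ∀ a b (p : Walk G (toFin a) (toFin b)) → len p ≡ dist a b → IsShortest p
  shortest-if-len≡dist a b p len≡ =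
    shortest-by-potential (dist-lipschitz b)
      (trans (cong (λ x → dist x b) (fromFin-toFin b)) (dist-self b)) p
      (trans len≡ (cong (λ x → dist x b) (sym (fromFin-toFin a))))

  forth : ∀ {a b} → Edge a b → Adj G (toFin a) (toFin b)
  forth e = inj₁ (Edge⇒∈E e)

  back : ∀ {a b} → Edge a b → Adj G (toFin b) (toFin a)
  back e = inj₂ (Edge⇒∈E e)

  chainWalk : ∀ v i j → Walk G (toFin (vⱼ v i)) (toFin (vⱼ v j))
  chainWalk v 0F 0F = []
  chainWalk v 0F 1F = forth (v₁-v₂ v) ∷ []
  chainWalk v 0F 2F = forth (v₁-v₂ v) ∷ forth (v₂-v₃ v) ∷ []
  chainWalk v 1F 0F = back (v₁-v₂ v) ∷ []
  chainWalk v 1F 1F = []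
  chainWalk v 1F 2F = forth (v₂-v₃ v) ∷ []
  chainWalk v 2F 0F = back (v₂-v₃ v) ∷ back (v₁-v₂ v) ∷ []
  chainWalk v 2F 1F = back (v₂-v₃ v) ∷ []
  chainWalk v 2F 2F = []

  len-chainWalk : ∀ v i j → len (chainWalk v i j) ≡ ∣ toℕ i - toℕ j ∣
  len-chainWalk v 0F 0F = refl
  len-chainWalk v 0F 1F = refl
  len-chainWalk v 0F 2F = refl
  len-chainWalk v 1F 0F = refl
  len-chainWalk v 1F 1F = refl
  len-chainWalk v 1F 2F = refl
  len-chainWalk v 2F 0F = refl
  len-chainWalk v 2F 1F = refl
  len-chainWalk v 2F 2F = refl

  up : ∀ v i → Walk G (toFin (vⱼ v i)) (toFin w)
  up v i = chainWalk v i 0F ++ʷ (back (w-v₁ v) ∷ [])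

  len-up : ∀ v i → len (up v i) ≡ height (vⱼ v i)
  len-up v 0F = refl
  len-up v 1F = refl
  len-up v 2F = refl

  down : ∀ v j → Walk G (toFin w) (toFin (vⱼ v j))
  down v j = forth (w-v₁ v) ∷ chainWalk v 0F j

  len-down : ∀ v j → len (down v j) ≡ height (vⱼ v j)
  len-down v j = cong suc (len-chainWalk v 0F j)

  inC : Fin n' → Bool
  inC = lookup C

  -- Each edge of G' is charged to an endpoint in C (its hub end) and recorded at the other end.
  hubEnd otherEnd : Fin n' × Fin n' → Fin n'
  hubEnd   (p , q) = if inC p then p else q
  otherEnd (p , q) = if inC p then q else p

  edgeHubs : List (Fin n' × Fin n') → Fin n' → List Vertex
  edgeHubs []       x = []
  edgeHubs (e ∷ es) x =
    if does (otherEnd e Fin.≟ x) then vⱼ (hubEnd e) 0F ∷ edgeHubs es x else edgeHubs es x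

  chainHubs : Bool → Fin n' → Fin 3 → List Vertex
  chainHubs true  v 0F = []
  chainHubs true  v 1F = vⱼ v 0F ∷ []
  chainHubs true  v 2F = vⱼ v 0F ∷ vⱼ v 1F ∷ []
  chainHubs false v 0F = vⱼ v 1F ∷ []
  chainHubs false v 1F = []
  chainHubs false v 2F = vⱼ v 1F ∷ []

  label : Vertex → List Vertex
  label w        = w ∷ []
  label (wᵢ i)   = wᵢ i ∷ w ∷ []
  label (vⱼ v j) = vⱼ v j ∷ w ∷ chainHubs (inC v) v j ++ edgeHubs E' v

  ℓ : Fin N → Subset N
  ℓ x = fromList (map toFin (label (fromFin x)))

  ∈label⇒∈ℓ : ∀ a {y} → y ∈ᴸ label a → toFin y ∈ ℓ (toFin a)
  ∈label⇒∈ℓ a y∈ rewrite fromFin-toFin a = ∈ᴸ⇒∈fromList (∈-map⁺ toFin y∈)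

  ∣ℓ∣≤length-label : ∀ x → ∣ ℓ x ∣ ≤ length (label (fromFin x))
  ∣ℓ∣≤length-label x = ≤-trans (∣fromList∣≤length (map toFin (label (fromFin x))))
                                (≤-reflexive (length-map toFin (label (fromFin x))))

  w∈label : ∀ a → w ∈ᴸ label a
  w∈label w        = here refl
  w∈label (wᵢ i)   = there (here refl)
  w∈label (vⱼ v j) = there (here refl)

  chainHubs⊆label : ∀ {v b y} j → inC v ≡ b → y ∈ᴸ chainHubs b v j → y ∈ᴸ label (vⱼ v j)
  chainHubs⊆label j refl y∈ = there (there (∈-++⁺ˡ y∈))

  edgeHubs⊆label : ∀ {v y} j → y ∈ᴸ edgeHubs E' v → y ∈ᴸ label (vⱼ v j)
  edgeHubs⊆label {v} j y∈ = there (there (∈-++⁺ʳ (chainHubs (inC v) v j) y∈))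

  Hubbed : Fin N → Fin N → Set
  Hubbed s t = Σ (Walk G s t) λ p → IsShortest p × ∃ λ x → x OnWalk p × x ∈ ℓ s × x ∈ ℓ t

  hubbed : ∀ a b (p : Walk G (toFin a) (toFin b)) → len p ≡ dist a b →
           ∀ y → toFin y OnWalk p → y ∈ᴸ label a → y ∈ᴸ label b → Hubbed (toFin a) (toFin b)
  hubbed a b p len≡ y y∈p y∈a y∈b =
    p , shortest-if-len≡dist a b p len≡ , toFin y , y∈p , ∈label⇒∈ℓ a y∈a , ∈label⇒∈ℓ b y∈b

  hubbed-via-w : ∀ a b (p : Walk G (toFin a) (toFin b)) → len p ≡ dist a b → toFin w OnWalk p →
                 Hubbed (toFin a) (toFin b)
  hubbed-via-w a b p len≡ w-on = hubbed a b p len≡ w w-on (w∈label a) (w∈label b)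

  ChainHub : Fin n' → Fin 3 → Fin 3 → Set
  ChainHub v i j = Σ Vertex λ y → toFin y OnWalk chainWalk v i j × y ∈ᴸ label (vⱼ v i) × y ∈ᴸ label (vⱼ v j)

  chainHub : ∀ v b → inC v ≡ b → ∀ i j → ChainHub v i j
  chainHub v b     eq 0F 0F = vⱼ v 0F , here , here refl , here refl
  chainHub v b     eq 1F 1F = vⱼ v 1F , here , here refl , here refl
  chainHub v b     eq 2F 2F = vⱼ v 2F , here , here refl , here refl
  chainHub v true  eq 0F 1F = vⱼ v 0F , here , here refl , chainHubs⊆label 1F eq (here refl)
  chainHub v true  eq 0F 2F = vⱼ v 0F , here , here refl , chainHubs⊆label 2F eq (here refl)
  chainHub v true  eq 1F 0F = vⱼ v 0F , there here , chainHubs⊆label 1F eq (here refl) , here refl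
  chainHub v true  eq 1F 2F = vⱼ v 1F , here , here refl , chainHubs⊆label 2F eq (there (here refl))
  chainHub v true  eq 2F 0F = vⱼ v 0F , there (there here) , chainHubs⊆label 2F eq (here refl) , here refl
  chainHub v true  eq 2F 1F = vⱼ v 1F , there here , chainHubs⊆label 2F eq (there (here refl)) , here refl
  chainHub v false eq 0F 1F = vⱼ v 1F , there here , chainHubs⊆label 0F eq (here refl) , here refl
  chainHub v false eq 0F 2F = vⱼ v 1F , there here , chainHubs⊆label 0F eq (here refl) , chainHubs⊆label 2F eq (here refl)
  chainHub v false eq 1F 0F = vⱼ v 1F , here , here refl , chainHubs⊆label 0F eq (here refl)
  chainHub v false eq 1F 2F = vⱼ v 1F , here , here refl , chainHubs⊆label 2F eq (here refl)
  chainHub v false eq 2F 0F = vⱼ v 1F , there here , chainHubs⊆label 2F eq (here refl) , chainHubs⊆label 0F eq (here refl)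
  chainHub v false eq 2F 1F = vⱼ v 1F , there here , chainHubs⊆label 2F eq (here refl) , here refl

  AdjHub : Fin n' → Fin n' → Set
  AdjHub v u = Σ (Fin n') λ h → (h ≡ v ⊎ h ≡ u) ×
    (∀ t → vⱼ h 0F ∈ᴸ label (vⱼ v t)) × (∀ t → vⱼ h 0F ∈ᴸ label (vⱼ u t))

  AdjHub-sym : ∀ {v u} → AdjHub v u → AdjHub u v
  AdjHub-sym (h , inj₁ h≡v , h∈v , h∈u) = h , inj₂ h≡v , h∈u , h∈v
  AdjHub-sym (h , inj₂ h≡u , h∈v , h∈u) = h , inj₁ h≡u , h∈u , h∈v

  v₁∈label : ∀ {v} → inC v ≡ true → ∀ t → vⱼ v 0F ∈ᴸ label (vⱼ v t)
  v₁∈label v∈C 0F = here refl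
  v₁∈label v∈C 1F = chainHubs⊆label 1F v∈C (here refl)
  v₁∈label v∈C 2F = chainHubs⊆label 2F v∈C (here refl)

  hubEnd∈C : ∀ {p q} → (p , q) ∈ᴸ E' → inC (hubEnd (p , q)) ≡ true
  hubEnd∈C {p} pq∈E' with inC p in p∈C | All.lookup cover pq∈E'
  ... | true  | _        = p∈C
  ... | false | inj₁ p∈C' = contradiction (trans (sym ([]=⇒lookup p∈C')) p∈C) λ ()
  ... | false | inj₂ q∈C = []=⇒lookup q∈C

  edgeHubs-∋ : ∀ {e} es → e ∈ᴸ es → vⱼ (hubEnd e) 0F ∈ᴸ edgeHubs es (otherEnd e)
  edgeHubs-∋ {e} (e ∷ es) (here refl) rewrite dec-true (otherEnd e Fin.≟ otherEnd e) refl = here refl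
  edgeHubs-∋ {e} (f ∷ es) (there e∈es) with does (otherEnd f Fin.≟ otherEnd e)
  ... | true  = there (edgeHubs-∋ es e∈es)
  ... | false = edgeHubs-∋ es e∈es

  edge-AdjHub : ∀ {e} → e ∈ᴸ E' → AdjHub (hubEnd e) (otherEnd e)
  edge-AdjHub {e} e∈E' =
    hubEnd e , inj₁ refl , v₁∈label (hubEnd∈C e∈E') , λ t → edgeHubs⊆label t (edgeHubs-∋ E' e∈E')

  hubEnd-otherEnd : ∀ p q → (hubEnd (p , q) ≡ p × otherEnd (p , q) ≡ q) ⊎ (hubEnd (p , q) ≡ q × otherEnd (p , q) ≡ p)
  hubEnd-otherEnd p q with inC p
  ... | true  = inj₁ (refl , refl)
  ... | false = inj₂ (refl , refl)

  edgeHub : ∀ {p q} → (p , q) ∈ᴸ E' → AdjHub p q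
  edgeHub {p} {q} pq∈E' with hubEnd-otherEnd p q
  ... | inj₁ (h≡p , o≡q) = subst₂ AdjHub h≡p o≡q (edge-AdjHub pq∈E')
  ... | inj₂ (h≡q , o≡p) = AdjHub-sym (subst₂ AdjHub h≡q o≡p (edge-AdjHub pq∈E'))

  adjHub : ∀ {v u} → Adj G' v u → AdjHub v u
  adjHub (inj₁ vu∈E') = edgeHub vu∈E'
  adjHub (inj₂ uv∈E') = AdjHub-sym (edgeHub uv∈E')

  bridge : ∀ {v u} → Adj G' v u → Adj G (toFin (vⱼ v 0F)) (toFin (vⱼ u 0F))
  bridge (inj₁ vu∈E') = forth (u₁-v₁ vu∈E')
  bridge (inj₂ uv∈E') = back (u₁-v₁ uv∈E')

  hubbed-adjacent : ∀ {v u} i j → Adj G' v u → dist (vⱼ v i) (vⱼ u j) ≡ toℕ i + suc (toℕ j) →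
                    Hubbed (toFin (vⱼ v i)) (toFin (vⱼ u j))
  hubbed-adjacent {v} {u} i j vu dist≡ with adjHub vu
  ... | h , h≡v⊎u , h∈v , h∈u = hubbed (vⱼ v i) (vⱼ u j) p len-p (vⱼ h 0F) (h-on h≡v⊎u) (h∈v i) (h∈u j)
    where
    p : Walk G (toFin (vⱼ v i)) (toFin (vⱼ u j))
    p = chainWalk v i 0F ++ʷ (bridge vu ∷ chainWalk u 0F j)

    len-p : len p ≡ dist (vⱼ v i) (vⱼ u j)
    len-p = begin
      len p                                                      ≡⟨ len-++ʷ (chainWalk v i 0F) _ ⟩
      len (chainWalk v i 0F) + suc (len (chainWalk u 0F j))
        ≡⟨ cong₂ (λ a b → a + suc b) (len-chainWalk v i 0F) (len-chainWalk u 0F j) ⟩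
      ∣ toℕ i - 0 ∣ + suc (toℕ j)                                ≡⟨ cong (_+ suc (toℕ j)) (∣-∣-identityʳ (toℕ i)) ⟩
      toℕ i + suc (toℕ j)                                        ≡⟨ dist≡ ⟨
      dist (vⱼ v i) (vⱼ u j)                                     ∎
      where open ≡-Reasoning

    h-on : h ≡ v ⊎ h ≡ u → toFin (vⱼ h 0F) OnWalk p
    h-on (inj₁ refl) = OnWalk-++ʷˡ (target-OnWalk (chainWalk v i 0F))
    h-on (inj₂ refl) = OnWalk-++ʷʳ (chainWalk v i 0F) (there here)

  hubbed-chains : ∀ v u i j (d : Dec (v ≡ u)) (a : Dec (Adj G' v u)) →
                  dist (vⱼ v i) (vⱼ u j) ≡ chainDist i j d a → Hubbed (toFin (vⱼ v i)) (toFin (vⱼ u j))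
  hubbed-chains v v i j (yes refl) _ dist≡ with chainHub v (inC v) refl i j
  ... | y , y-on , y∈i , y∈j =
    hubbed (vⱼ v i) (vⱼ v j) (chainWalk v i j) (trans (len-chainWalk v i j) (sym dist≡)) y y-on y∈i y∈j
  hubbed-chains v u i j (no _) (yes vu) dist≡ = hubbed-adjacent i j vu dist≡
  hubbed-chains v u i j (no _) (no _)   dist≡ =
    hubbed-via-w (vⱼ v i) (vⱼ u j) (up v i ++ʷ down u j) len≡ (OnWalk-++ʷˡ (target-OnWalk (up v i)))
    where
    len≡ = trans (len-++ʷ (up v i) (down u j)) (trans (cong₂ _+_ (len-up v i) (len-down u j)) (sym dist≡))

  hubbed-all : ∀ a b → Hubbed (toFin a) (toFin b)
  hubbed-all w        w        = hubbed-via-w w w [] refl here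
  hubbed-all (wᵢ i)   w        = hubbed-via-w (wᵢ i) w (back (w-wᵢ i) ∷ []) refl (there here)
  hubbed-all (vⱼ v i) w        = hubbed-via-w (vⱼ v i) w (up v i) (len-up v i) (target-OnWalk (up v i))
  hubbed-all w        (wᵢ i)   = hubbed-via-w w (wᵢ i) (forth (w-wᵢ i) ∷ []) refl here
  hubbed-all w        (vⱼ u j) = hubbed-via-w w (vⱼ u j) (down u j) (len-down u j) here
  hubbed-all (wᵢ i)   (wᵢ i') with i Fin.≟ i'
  ... | yes refl = hubbed (wᵢ i) (wᵢ i) [] (sym (dist-self (wᵢ i))) (wᵢ i) here (here refl) (here refl)
  ... | no i≢i'  = hubbed-via-w (wᵢ i) (wᵢ i') (back (w-wᵢ i) ∷ forth (w-wᵢ i') ∷ []) len≡ (there here)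
    where len≡ = cong (λ b → if b then 0 else 2) (sym (dec-false (i Fin.≟ i') i≢i'))
  hubbed-all (vⱼ v i) (wᵢ i')  = hubbed-via-w (vⱼ v i) (wᵢ i') (up v i ++ʷ (forth (w-wᵢ i') ∷ [])) len≡
                                   (OnWalk-++ʷˡ (target-OnWalk (up v i)))
    where len≡ = trans (len-++ʷ (up v i) _) (cong (_+ 1) (len-up v i))
  hubbed-all (wᵢ i)   (vⱼ u j) = hubbed-via-w (wᵢ i) (vⱼ u j) (back (w-wᵢ i) ∷ down u j) (cong suc (len-down u j))
                                   (there here)
  hubbed-all (vⱼ v i) (vⱼ u j) = hubbed-chains v u i j (v Fin.≟ u) (adj? v u) refl

  isHubLabeling : IsHubLabeling G ℓ
  isHubLabeling x y = subst₂ Hubbed (toFin-fromFin x) (toFin-fromFin y) (hubbed-all (fromFin x) (fromFin y))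

  ∑-chain-label : ∀ b v R → ∑[ j < 3 ] (2 + length (chainHubs b v j ++ R)) ≡ 8 + χ b + 3 * length R
  ∑-chain-label true  v R = lemma (length R)
    where lemma : ∀ r → 2 + r + (3 + r + (4 + r + 0)) ≡ 8 + 1 + 3 * r
          lemma = solve-∀
  ∑-chain-label false v R = lemma (length R)
    where lemma : ∀ r → 3 + r + (2 + r + (3 + r + 0)) ≡ 8 + 0 + 3 * r
          lemma = solve-∀

  length-edgeHubs-∷ : ∀ e es v → length (edgeHubs (e ∷ es) v) ≡ χ (does (otherEnd e Fin.≟ v)) + length (edgeHubs es v)
  length-edgeHubs-∷ e es v with does (otherEnd e Fin.≟ v)
  ... | true  = refl
  ... | false = refl

  ∑-edgeHubs : ∀ es → ∑[ v < n' ] length (edgeHubs es v) ≡ length es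
  ∑-edgeHubs []       = trans (∑-const n' 0) (*-zeroʳ n')
  ∑-edgeHubs (e ∷ es) = begin
    ∑[ v < n' ] length (edgeHubs (e ∷ es) v)                   ≡⟨ sum-cong-≗ (length-edgeHubs-∷ e es) ⟩
    ∑[ v < n' ] (hit v + length (edgeHubs es v))                 ≡⟨ ∑-distrib-+ hit (λ v → length (edgeHubs es v)) ⟩
    ∑[ v < n' ] hit v + ∑[ v < n' ] length (edgeHubs es v)       ≡⟨ cong₂ _+_ (∑-χ-≟ (otherEnd e)) (∑-edgeHubs es) ⟩
    suc (length es)                                            ∎
    where
    open ≡-Reasoning
    hit : Fin n' → ℕ
    hit v = χ (does (otherEnd e Fin.≟ v))

  m' : ℕ
  m' = length E'

  ∑-chain-labels : ∑[ v < n' ] ∑[ j < 3 ] length (label (vⱼ v j)) ≡ n' * 8 + ∣ C ∣ + 3 * m'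
  ∑-chain-labels = begin
    ∑[ v < n' ] ∑[ j < 3 ] length (label (vⱼ v j))
      ≡⟨ sum-cong-≗ (λ v → ∑-chain-label (inC v) v (edgeHubs E' v)) ⟩
    ∑[ v < n' ] (8 + χ (inC v) + 3 * length (edgeHubs E' v))
      ≡⟨ ∑-distrib-+ (λ v → 8 + χ (inC v)) (λ v → 3 * length (edgeHubs E' v)) ⟩
    ∑[ v < n' ] (8 + χ (inC v)) + ∑[ v < n' ] (3 * length (edgeHubs E' v))
      ≡⟨ cong₂ _+_ (∑-distrib-+ (λ _ → 8) (χ ∘ inC)) (∑-*-distribˡ 3 (λ v → length (edgeHubs E' v))) ⟩
    ∑[ v < n' ] 8 + ∑[ v < n' ] χ (inC v) + 3 * ∑[ v < n' ] length (edgeHubs E' v)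
      ≡⟨ cong₂ _+_ (cong₂ _+_ (∑-const n' 8) (∑-χ-lookup C)) (cong (3 *_) (∑-edgeHubs E')) ⟩
    n' * 8 + ∣ C ∣ + 3 * m'
      ∎
    where open ≡-Reasoning

  ∑-length-label : ∑[ x < N ] length (label (fromFin x)) ≡ 1 + (γ * 2 + (n' * 8 + ∣ C ∣ + 3 * m'))
  ∑-length-label = cong suc (begin
    ∑[ x < γ + n' * 3 ] length (label (fromFin (suc x)))
      ≡⟨ ∑-↑ γ (n' * 3) _ ⟩
    ∑[ i < γ ] length (label (fromFin (wI i))) + ∑[ c < n' * 3 ] length (label (fromFin (suc (γ ↑ʳ c))))
      ≡⟨ cong₂ _+_ (sum-cong-≗ (λ i → cong (length ∘ label) (fromFin-toFin (wᵢ i)))) (∑-combine n' 3 _) ⟩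
    ∑[ i < γ ] 2 + ∑[ v < n' ] ∑[ j < 3 ] length (label (fromFin (vJ v j)))
      ≡⟨ cong₂ _+_ (∑-const γ 2) (sum-cong-≗ λ v → sum-cong-≗ λ j → cong (length ∘ label) (fromFin-toFin (vⱼ v j))) ⟩
    γ * 2 + ∑[ v < n' ] ∑[ j < 3 ] length (label (vⱼ v j))
      ≡⟨ cong (γ * 2 +_) ∑-chain-labels ⟩
    γ * 2 + (n' * 8 + ∣ C ∣ + 3 * m')
      ∎)
    where open ≡-Reasoning

  k≡ : k ≡ 1 + (γ * 2 + (n' * 8 + k' + 3 * m'))
  k≡ = cong (_∸ 1) (identity n' m' k')
    where identity : ∀ a m c → 3 * (8 * a + 3 * m + c + 2) ≡ 2 + ((8 * a + 3 * m + c + 2) * 2 + (a * 8 + c + 3 * m))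
          identity = solve-∀

  hlSize≤k : ∣ C ∣ ≤ k' → hlSize G ℓ ≤ k
  hlSize≤k ∣C∣≤k' = begin
    hlSize G ℓ                                ≡⟨ sum-map-tabulate N id (λ x → ∣ ℓ x ∣) ⟩
    ∑[ x < N ] ∣ ℓ x ∣                         ≤⟨ ∑-mono-≤ ∣ℓ∣≤length-label ⟩
    ∑[ x < N ] length (label (fromFin x))     ≡⟨ ∑-length-label ⟩
    1 + (γ * 2 + (n' * 8 + ∣ C ∣ + 3 * m'))
      ≤⟨ +-monoʳ-≤ 1 (+-monoʳ-≤ (γ * 2) (+-monoˡ-≤ (3 * m') (+-monoʳ-≤ (n' * 8) ∣C∣≤k'))) ⟩
    1 + (γ * 2 + (n' * 8 + k' + 3 * m'))      ≡⟨ k≡ ⟨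
    k                                         ∎
    where open ≤-Reasoning

lemma2 : (G' : Graph) (k' : ℕ) → Simple G' →
    (Σ (Subset (n G')) λ C → VertexCover G' C × ∣ C ∣ ≤ k') →
    Σ (_ → Subset (n (constructG G' k'))) λ ℓ →
      IsHubLabeling (constructG G' k') ℓ × hlSize (constructG G' k') ℓ ≤ constructK G' k'
lemma2 G' k' _ (C , cover , ∣C∣≤k') = ℓ , isHubLabeling , hlSize≤k ∣C∣≤k'
  where open Reduction G' k' C cover
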